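{- Let $k\geq 4$ be an integer, let $K$ be a complete subgraph of a graph $G$ with $k-1$ vertices, and let $u,v$ be adjacent vertices in $V(G)\setminus V(K)$ that are both adjacent to all vertices of $K$. Then for any orientation $\vec K$ of $K$, $c_{\mathcal{S}_k}(\{u,v\},\vec K)<2\cdot 3\cdot 2^{2k-5}$.
   Context: A tournament is an orientation of a complete graph; it is strongly connected if for every ordered pair of vertices there is a directed path from the first to the second. $\mathcal{S}_k$ is the family of all strongly connected tournaments on $k$ vertices; an orientation is $\mathcal{S}_k$-free if no $k$ of its vertices induce a strongly connected tournament. For an orientation $\vec K$ of $K$, $c_{\mathcal{S}_k}(\{u,v\},\vec K)$ is the number of ways to orient all edges of $G[V(K)\cup\{u,v\}]$ not in $K$ (the edge $\{u,v\}$ and the edges between $\{u,v\}$ and $V(K)$) so that the resulting orientation of $G[V(K)\cup\{u,v\}]$ extending $\vec K$ is $\mathcal{S}_k$-free. -}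

module Defs where

open import Data.Nat using (ℕ; zero; suc; _<_; _≤_; _∸_)
open import Data.Fin using (Fin; zero; suc)
open import Data.Bool using (Bool; true; false; not; T)
open import Data.Vec using (Vec; lookup)
open import Data.Fin.Subset using (Subset; _∈_; ∣_∣)
open import Data.Product using (_×_; _,_; Σ; ∃)
open import Data.List using (List; length)
open import Data.List.Relation.Unary.All using (All)
open import Data.List.Relation.Unary.Unique.Propositional using (Unique)
open import Relation.Binary.PropositionalEquality using (_≡_; _≢_)
open import Relation.Nullary using (¬_)

record Graph (n : ℕ) : Set₁ where
  field
    Adj   : Fin n → Fin n → Set
    sym   : ∀ {x y} → Adj x y → Adj y x
    irrefl : ∀ {x} → ¬ Adj x x
open Graph public

IsCompleteSubgraph : ∀ {n} → Graph n → (m : ℕ) → (Fin m → Fin n) → Set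
IsCompleteSubgraph G m K =
  (∀ i j → K i ≡ K j → i ≡ j) × (∀ i j → i ≢ j → Adj G (K i) (K j))

-- An orientation of the complete graph on the index set Fin m
-- (i.e. of K, via its enumeration): O i j = true means the arc K_i → K_j;
-- for distinct i, j exactly one direction is present.
IsTournament : (m : ℕ) → (Fin m → Fin m → Bool) → Set
IsTournament m O = ∀ i j → i ≢ j → O j i ≡ not (O i j)

-- The vertex set V(K) ∪ {u,v} is indexed by Fin (2 + m):
-- zero = u, suc zero = v, suc (suc i) = K_i.  An orientation of the edges of
-- G[V(K) ∪ {u,v}] not in K is given by
--   e      : true iff the edge uv is oriented u → v,
--   a ! i  : true iff the edge u K_i is oriented u → K_i,
--   b ! i  : true iff the edge v K_i is oriented v → K_i.

Ext : ℕ → Set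
Ext m = Bool × Vec Bool m × Vec Bool m

arc : ∀ {m} → (Fin m → Fin m → Bool) → Ext m → Fin (suc (suc m)) → Fin (suc (suc m)) → Bool
arc O (e , a , b) zero zero = false
arc O (e , a , b) zero (suc zero) = e
arc O (e , a , b) zero (suc (suc j)) = lookup a j
arc O (e , a , b) (suc zero) zero = not e
arc O (e , a , b) (suc zero) (suc zero) = false
arc O (e , a , b) (suc zero) (suc (suc j)) = lookup b j
arc O (e , a , b) (suc (suc i)) zero = not (lookup a i)
arc O (e , a , b) (suc (suc i)) (suc zero) = not (lookup b i)
arc O (e , a , b) (suc (suc i)) (suc (suc j)) = O i j

data Reach {N : ℕ} (A : Fin N → Fin N → Bool) (S : Subset N) : Fin N → Fin N → Set where
  here  : ∀ {x} → Reach A S x x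
  there : ∀ {x y z} → T (A x y) → y ∈ S → Reach A S y z → Reach A S x z

StronglyConnectedOn : ∀ {N} → (Fin N → Fin N → Bool) → Subset N → Set
StronglyConnectedOn A S = ∀ x y → x ∈ S → y ∈ S → Reach A S x y

-- S_k-free: no k vertices induce a strongly connected tournament
-- (A is itself a tournament, so every induced subdigraph is a tournament).
SkFree : ∀ {N} → ℕ → (Fin N → Fin N → Bool) → Set
SkFree k A = ∀ (S : Subset _) → ∣ S ∣ ≡ k → ¬ StronglyConnectedOn A S

-- "The number of x : X with P x is less than B"  (X has decidable equality
-- here, so this is the usual cardinality bound): every duplicate-free list
-- of elements satisfying P has length less than B.

CountLess : {X : Set} → (X → Set) → ℕ → Set
CountLess {X} P B = ∀ (xs : List X) → Unique xs → All P xs → length xs < B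

CSkLess : ∀ (k : ℕ) → (Fin (k ∸ 1) → Fin (k ∸ 1) → Bool) → ℕ → Set
CSkLess k O B = CountLess (λ (x : Ext (k ∸ 1)) → SkFree k (arc O x)) B

module Submission where

-- Let w₁ ⟶ w₂ ⟶ ⋯ ⟶ wₚ ⟶ wₘ be a Hamiltonian path of the tournament on K (Rédei).  The
-- extended tournament has k + 1 vertices, so it is S_k-free only if none of the
-- subtournaments obtained by deleting one vertex is strongly connected.  Seven arc patterns
-- among u, v, w₁, w₂, wₚ, wₘ each produce a closed walk through all vertices but one of
-- v, u, wₘ, w₁, hence are excluded.  Only 186 of the 2⁹ possible restrictions of an
-- extension to the arc uv and the arcs from u, v to w₁, w₂, wₚ, wₘ avoid all seven
-- (46 of 2⁷ when k = 4, where wₚ = w₂), while the remaining 2(k − 5) arcs are arbitrary: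
-- 186 · 4^(k−5) < 192 · 4^(k−5) = 6 · 2^(2k−5).

open import Data.Bool using (Bool; true; false; not; T; if_then_else_)
open import Data.Bool.Properties using (T?)
open import Data.Empty using (⊥-elim)
open import Data.Fin using (Fin; zero; suc)
open import Data.Fin.Properties using (suc-injective)
open import Data.Fin.Subset using (∁; ⁅_⁆; ∣_∣) renaming (_∈_ to _∈ₛ_)
open import Data.Fin.Subset.Properties
  using (x∉p⇒x∈∁p; x∈∁p⇒x∉p; x≢y⇒x∉⁅y⁆; x∉⁅y⁆⇒x≢y; ∣∁p∣≡n∸∣p∣; ∣⁅x⁆∣≡1)
open import Data.List
  using (List; []; _∷_; [_]; _++_; _∷ʳ_; length; map; foldr; filter; allFin; cartesianProduct; initLast; _∷ʳ′_)
open import Data.List.Membership.Propositional using (_∈_)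
open import Data.List.Membership.Propositional.Properties
  using (∈-++⁺ˡ; ∈-++⁺ʳ; ∈-++⁻; ∈-map⁺; ∈-map⁻; ∈-∃++; ∈-allFin; ∈-filter⁺; ∈-cartesianProduct⁺)
open import Data.List.Properties using (length-++; length-map; length-tabulate)
open import Data.List.Relation.Binary.Permutation.Propositional
  using (_↭_; prep; swap; ↭-refl; ↭-sym; ↭-trans; ↭⇒↭ₛ)
open import Data.List.Relation.Binary.Permutation.Propositional.Properties
  using (∈-resp-↭; All-resp-↭; ↭-length; ∷↭∷ʳ)
open import Data.List.Relation.Binary.Subset.Propositional using (_⊆_)
open import Data.List.Relation.Unary.All as All using (All; []; _∷_)
open import Data.List.Relation.Unary.All.Properties using (++⁺; map⁺)
open import Data.List.Relation.Unary.AllPairs using ([]; _∷_)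
open import Data.List.Relation.Unary.Any using (here; there)
open import Data.List.Relation.Unary.Linked using (Linked; []; [-]; _∷_)
open import Data.List.Relation.Unary.Unique.Propositional using (Unique)
open import Data.List.Relation.Unary.Unique.Propositional.Properties
  using (allFin⁺) renaming (map⁺ to Unique-map⁺)
open import Data.Nat using (ℕ; zero; suc; _+_; _*_; _^_; _∸_; _≤_; _<_; z≤n; s≤s; z<s)
open import Data.Nat.Properties
  using ( ≤-trans; ≤-reflexive; n≤1+n; +-suc; +-identityʳ; +-cancelˡ-≡; ^-distribˡ-+-*
        ; *-monoˡ-<; m<m+n; m*n≢0; m^n≢0; module ≤-Reasoning)
open import Data.Nat.Tactic.RingSolver using (solve-∀)
open import Data.Product using (_×_; _,_; proj₁; proj₂)
open import Data.Sum using (inj₁; inj₂)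
open import Data.Unit using (tt)
open import Data.Vec as Vec using (Vec; lookup; []; _∷_)
open import Data.Vec.Properties using (∷-injective; tabulate∘lookup; tabulate-cong)
open import Function using (_∘_; id)
open import Relation.Binary.PropositionalEquality
  using (_≡_; _≢_; refl; sym; trans; cong; cong₂; subst; ≢-sym; setoid; module ≡-Reasoning)
open import Relation.Nullary using (¬_; ¬?; contradiction)
open import Relation.Unary using (Decidable)

open import Defs
  using ( Graph; Adj; IsCompleteSubgraph; IsTournament; Ext; arc; Reach; here; there
        ; StronglyConnectedOn; SkFree; CountLess; CSkLess)

private
  variable
    m n N : ℕ

Unique-⊆⇒length≤ : {A : Set} {xs ys : List A} → Unique xs → xs ⊆ ys → length xs ≤ length ys
Unique-⊆⇒length≤ {xs = []} _ _ = z≤n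
Unique-⊆⇒length≤ {xs = x ∷ xs} (x∉xs ∷ u) xs⊆ys with ∈-∃++ (xs⊆ys (here refl))
... | ys₁ , ys₂ , refl =
  ≤-trans (s≤s (Unique-⊆⇒length≤ u xs⊆ys₁++ys₂)) (≤-reflexive length-removed)
  where
  xs⊆ys₁++ys₂ : xs ⊆ ys₁ ++ ys₂
  xs⊆ys₁++ys₂ {z} z∈xs with ∈-++⁻ ys₁ (xs⊆ys (there z∈xs))
  ... | inj₁ z∈ys₁ = ∈-++⁺ˡ z∈ys₁
  ... | inj₂ (here refl) = ⊥-elim (All.lookup x∉xs z∈xs refl)
  ... | inj₂ (there z∈ys₂) = ∈-++⁺ʳ ys₁ z∈ys₂
  length-removed : suc (length (ys₁ ++ ys₂)) ≡ length (ys₁ ++ x ∷ ys₂)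
  length-removed rewrite length-++ ys₁ {ys₂} | length-++ ys₁ {x ∷ ys₂} =
    sym (+-suc (length ys₁) (length ys₂))

length-cartesianProduct : {A B : Set} (xs : List A) (ys : List B) →
  length (cartesianProduct xs ys) ≡ length xs * length ys
length-cartesianProduct [] ys = refl
length-cartesianProduct (x ∷ xs) ys =
  trans (length-++ (map (x ,_) ys)) (cong₂ _+_ (length-map (x ,_) ys) (length-cartesianProduct xs ys))

Unique-∷⁻ : {A : Set} {x : A} {xs : List A} → Unique (x ∷ xs) → All (_≢ x) xs
Unique-∷⁻ (x∉xs ∷ _) = All.map ≢-sym x∉xs

Unique-∷ʳ⁻ : {A : Set} {x : A} (xs : List A) → Unique (xs ∷ʳ x) → All (_≢ x) xs
Unique-∷ʳ⁻ [] _ = []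
Unique-∷ʳ⁻ (y ∷ xs) (y∉ ∷ u) = All.lookup y∉ (∈-++⁺ʳ xs (here refl)) ∷ Unique-∷ʳ⁻ xs u

∈-∷⁻ : {A : Set} {x y : A} {xs : List A} → y ∈ x ∷ xs → y ≢ x → y ∈ xs
∈-∷⁻ (here refl) y≢x = ⊥-elim (y≢x refl)
∈-∷⁻ (there y∈xs) _ = y∈xs

∈-∷ʳ⁻ : {A : Set} {x y : A} (xs : List A) → y ∈ xs ∷ʳ x → y ≢ x → y ∈ xs
∈-∷ʳ⁻ xs y∈ y≢x with ∈-++⁻ xs y∈
... | inj₁ y∈xs = y∈xs
... | inj₂ (here refl) = ⊥-elim (y≢x refl)

↭-allFin⇒Unique : {xs : List (Fin n)} → xs ↭ allFin n → Unique xs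
↭-allFin⇒Unique {n} xs↭ = Unique-resp-↭ (↭⇒↭ₛ (↭-sym xs↭)) (allFin⁺ n)
  where open import Data.List.Relation.Binary.Permutation.Setoid.Properties (setoid (Fin n)) using (Unique-resp-↭)

↭-allFin⇒∈ : {xs : List (Fin n)} → xs ↭ allFin n → ∀ i → i ∈ xs
↭-allFin⇒∈ xs↭ i = ∈-resp-↭ (↭-sym xs↭) (∈-allFin i)

data FourEnds {A : Set} : List A → Set where
  fourEnds : ∀ w₁ w₂ mid wₚ wₘ → FourEnds (w₁ ∷ w₂ ∷ (mid ∷ʳ wₚ) ∷ʳ wₘ)

fourEnds? : {A : Set} (xs : List A) → 4 ≤ length xs → FourEnds xs
fourEnds? [] ()
fourEnds? (_ ∷ []) (s≤s ())
fourEnds? (w₁ ∷ w₂ ∷ ys) 4≤ with initLast ys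
... | [] = contradiction 4≤ λ { (s≤s (s≤s ())) }
... | zs ∷ʳ′ wₘ with initLast zs
...   | [] = contradiction 4≤ λ { (s≤s (s≤s (s≤s ()))) }
...   | mid ∷ʳ′ wₚ = fourEnds w₁ w₂ mid wₚ wₘ

∷∷↭∷ʳ∷ʳ : {A : Set} (x y : A) (xs : List A) → x ∷ y ∷ xs ↭ (xs ∷ʳ x) ∷ʳ y
∷∷↭∷ʳ∷ʳ x y xs = ↭-trans (swap x y ↭-refl) (↭-trans (prep y (∷↭∷ʳ x xs)) (∷↭∷ʳ y (xs ∷ʳ x)))

-- Walks and strong connectivity

-- Walk A x ys z: a walk from x to z whose vertices after x are ys, in this order.
data Walk (A : Fin N → Fin N → Bool) : Fin N → List (Fin N) → Fin N → Set where
  []  : ∀ {x} → Walk A x [] x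
  _∷_ : ∀ {x y ys z} → T (A x y) → Walk A y ys z → Walk A x (y ∷ ys) z

module _ {A : Fin N → Fin N → Bool} where

  infixl 5 _▷_

  _▷_ : ∀ {x ys y z} → Walk A x ys y → T (A y z) → Walk A x (ys ∷ʳ z) z
  [] ▷ y⟶z = y⟶z ∷ []
  (x⟶x′ ∷ w) ▷ y⟶z = x⟶x′ ∷ (w ▷ y⟶z)

  Reach-trans : ∀ {S x y z} → Reach A S x y → Reach A S y z → Reach A S x z
  Reach-trans here r = r
  Reach-trans (there x⟶x′ x′∈S r) r′ = there x⟶x′ x′∈S (Reach-trans r r′)

  Walk⇒Reach : ∀ {S x ys z} → Walk A x ys z → All (_∈ₛ S) ys → Reach A S x z
  Walk⇒Reach [] [] = here
  Walk⇒Reach (x⟶y ∷ w) (y∈S ∷ ys⊆S) = there x⟶y y∈S (Walk⇒Reach w ys⊆S)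

  Walk⇒Reach-via : ∀ {S x ys y z} → Walk A x ys z → All (_∈ₛ S) ys → y ∈ ys →
                   Reach A S x y × Reach A S y z
  Walk⇒Reach-via (x⟶y ∷ w) (y∈S ∷ ys⊆S) (here refl) = there x⟶y y∈S here , Walk⇒Reach w ys⊆S
  Walk⇒Reach-via (x⟶x′ ∷ w) (x′∈S ∷ ys⊆S) (there y∈ys) =
    let x′⇝y , y⇝z = Walk⇒Reach-via w ys⊆S y∈ys in there x⟶x′ x′∈S x′⇝y , y⇝z

  closedWalk⇒StronglyConnectedOn : ∀ {S x ys} → Walk A x ys x → All (_∈ₛ S) ys →
                                   (∀ y → y ∈ₛ S → y ∈ ys) → StronglyConnectedOn A S
  closedWalk⇒StronglyConnectedOn w ys⊆S S⊆ys y z y∈S z∈S =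
    Reach-trans (proj₂ (Walk⇒Reach-via w ys⊆S (S⊆ys y y∈S)))
                (proj₁ (Walk⇒Reach-via w ys⊆S (S⊆ys z z∈S)))

Walk-map : ∀ {A : Fin N → Fin N → Bool} {B : Fin m → Fin m → Bool} (f : Fin m → Fin N) →
           (∀ {x y} → T (B x y) → T (A (f x) (f y))) →
           ∀ {x ys z} → Walk B x ys z → Walk A (f x) (map f ys) (f z)
Walk-map f hom [] = []
Walk-map f hom (x⟶y ∷ w) = hom x⟶y ∷ Walk-map f hom w

record SpanningClosedWalk (A : Fin N → Fin N → Bool) (d : Fin N) : Set where
  constructor spanning
  field
    {start}  : Fin N
    {others} : List (Fin N)
    walk     : Walk A start others start
    avoids   : All (_≢ d) others
    spans    : ∀ y → y ≢ d → y ∈ others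

SpanningClosedWalk⇒StronglyConnectedOn-∁ : ∀ {A : Fin N → Fin N → Bool} {d} →
  SpanningClosedWalk A d → StronglyConnectedOn A (∁ ⁅ d ⁆)
SpanningClosedWalk⇒StronglyConnectedOn-∁ (spanning w others≢d spans) =
  closedWalk⇒StronglyConnectedOn w (All.map (x∉p⇒x∈∁p ∘ x≢y⇒x∉⁅y⁆) others≢d)
    (λ y y∈S → spans y (x∉⁅y⁆⇒x≢y (x∈∁p⇒x∉p y∈S)))

SkFree⇒¬SpanningClosedWalk : ∀ {A : Fin (suc n) → Fin (suc n) → Bool} {d} →
  SkFree n A → ¬ SpanningClosedWalk A d
SkFree⇒¬SpanningClosedWalk {n} {d = d} skFree closedWalk =
  skFree (∁ ⁅ d ⁆) ∣∁⁅d⁆∣≡n (SpanningClosedWalk⇒StronglyConnectedOn-∁ closedWalk)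
  where
  ∣∁⁅d⁆∣≡n : ∣ ∁ ⁅ d ⁆ ∣ ≡ n
  ∣∁⁅d⁆∣≡n rewrite ∣∁p∣≡n∸∣p∣ ⁅ d ⁆ | ∣⁅x⁆∣≡1 d = refl

Linked⇒Walk▷ : ∀ {A : Fin N → Fin N → Bool} {x y z} xs →
  Linked (λ s t → T (A s t)) (x ∷ (xs ∷ʳ y) ∷ʳ z) → Walk A x (xs ∷ʳ y) y × T (A y z)
Linked⇒Walk▷ [] (x⟶y ∷ y⟶z ∷ [-]) = x⟶y ∷ [] , y⟶z
Linked⇒Walk▷ (_ ∷ xs) (x⟶x′ ∷ linked) = let x′⇝y , y⟶z = Linked⇒Walk▷ xs linked in x⟶x′ ∷ x′⇝y , y⟶z

-- Rédei's theorem

record HamiltonianPath (O : Fin m → Fin m → Bool) : Set where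
  field
    vertices   : List (Fin m)
    linked     : Linked (λ x y → T (O x y)) vertices
    enumerates : vertices ↭ allFin m

module Rédei (O : Fin m → Fin m → Bool) (tournament : IsTournament m O) where

  private
    _⟶_ : Fin m → Fin m → Set
    x ⟶ y = T (O x y)

  ⟶-flip : ∀ {x y} → x ≢ y → O x y ≡ false → y ⟶ x
  ⟶-flip {x} {y} x≢y x↛y rewrite tournament x y x≢y | x↛y = tt

  ⟶-true : ∀ {x y} → O x y ≡ true → x ⟶ y
  ⟶-true x⟶y = subst T (sym x⟶y) tt

  -- x goes just before the first vertex it beats; its predecessor, if any, then beats x.
  insert : Fin m → List (Fin m) → List (Fin m)
  insert x [] = [ x ]
  insert x (y ∷ ys) = if O x y then x ∷ y ∷ ys else y ∷ insert x ys

  insert-↭ : ∀ x ys → insert x ys ↭ x ∷ ys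
  insert-↭ x [] = ↭-refl
  insert-↭ x (y ∷ ys) with O x y
  ... | true = ↭-refl
  ... | false = ↭-trans (prep y (insert-↭ x ys)) (swap y x ↭-refl)

  insert-Linked-after : ∀ {x y ys} → y ⟶ x → All (x ≢_) ys →
                        Linked _⟶_ (y ∷ ys) → Linked _⟶_ (y ∷ insert x ys)
  insert-Linked-after y⟶x [] [-] = y⟶x ∷ [-]
  insert-Linked-after {x} {ys = z ∷ _} y⟶x (x≢z ∷ x∉zs) (y⟶z ∷ linked) with O x z in x→z
  ... | true = y⟶x ∷ ⟶-true x→z ∷ linked
  ... | false = y⟶z ∷ insert-Linked-after (⟶-flip x≢z x→z) x∉zs linked

  insert-Linked : ∀ {x ys} → All (x ≢_) ys → Linked _⟶_ ys → Linked _⟶_ (insert x ys)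
  insert-Linked [] [] = [-]
  insert-Linked {x} {ys = y ∷ _} (x≢y ∷ x∉ys) linked with O x y in x→y
  ... | true = ⟶-true x→y ∷ linked
  ... | false = insert-Linked-after (⟶-flip x≢y x→y) x∉ys linked

  path : List (Fin m) → List (Fin m)
  path = foldr insert []

  path-↭ : ∀ xs → path xs ↭ xs
  path-↭ [] = ↭-refl
  path-↭ (x ∷ xs) = ↭-trans (insert-↭ x (path xs)) (prep x (path-↭ xs))

  path-Linked : ∀ xs → Unique xs → Linked _⟶_ (path xs)
  path-Linked [] _ = []
  path-Linked (x ∷ xs) (x∉xs ∷ u) =
    insert-Linked (All-resp-↭ (↭-sym (path-↭ xs)) x∉xs) (path-Linked xs u)

  hamiltonianPath : HamiltonianPath O
  hamiltonianPath = record
    { vertices   = path (allFin m)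
    ; linked     = path-Linked (allFin m) (allFin⁺ m)
    ; enumerates = path-↭ (allFin m)
    }

-- A Hamiltonian path w₁ ⟶ w₂ ⇝ wₚ ⟶ wₘ with its ends named; for m = 3 it is w₁ ⟶ w₂ ⟶ wₘ,
-- with wₚ = w₂ and middle = [].
record PathEnds (O : Fin m → Fin m → Bool) : Set where
  field
    w₁ w₂ wₚ wₘ : Fin m
    middle     : List (Fin m)
    w₁⟶w₂      : T (O w₁ w₂)
    w₂⇝wₚ      : Walk O w₂ middle wₚ
    wₚ⟶wₘ      : T (O wₚ wₘ)
    enumerates : w₁ ∷ w₂ ∷ middle ∷ʳ wₘ ↭ allFin m

  w₁⇝wₘ : Walk O w₁ (w₂ ∷ middle ∷ʳ wₘ) wₘ
  w₁⇝wₘ = w₁⟶w₂ ∷ (w₂⇝wₚ ▷ wₚ⟶wₘ)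

  w₁⇝wₚ : Walk O w₁ (w₂ ∷ middle) wₚ
  w₁⇝wₚ = w₁⟶w₂ ∷ w₂⇝wₚ

  w₂⇝wₘ : Walk O w₂ (middle ∷ʳ wₘ) wₘ
  w₂⇝wₘ = w₂⇝wₚ ▷ wₚ⟶wₘ

  covers : ∀ i → i ∈ w₁ ∷ w₂ ∷ middle ∷ʳ wₘ
  covers = ↭-allFin⇒∈ enumerates

  covers-≢w₁ : ∀ {i} → i ≢ w₁ → i ∈ w₂ ∷ middle ∷ʳ wₘ
  covers-≢w₁ {i} = ∈-∷⁻ (covers i)

  covers-≢wₘ : ∀ {i} → i ≢ wₘ → i ∈ w₁ ∷ w₂ ∷ middle
  covers-≢wₘ {i} = ∈-∷ʳ⁻ (w₁ ∷ w₂ ∷ middle) (covers i)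

  others≢w₁ : All (_≢ w₁) (w₂ ∷ middle ∷ʳ wₘ)
  others≢w₁ = Unique-∷⁻ (↭-allFin⇒Unique enumerates)

  others≢wₘ : All (_≢ wₘ) (w₁ ∷ w₂ ∷ middle)
  others≢wₘ = Unique-∷ʳ⁻ (w₁ ∷ w₂ ∷ middle) (↭-allFin⇒Unique enumerates)

ι : Fin m → Fin (2 + m)
ι i = suc (suc i)

ι-injective : ∀ {i j : Fin m} → ι i ≡ ι j → i ≡ j
ι-injective = suc-injective ∘ suc-injective

-- p, q are u, v in either order, so that each configuration below also covers its mirror image.
data Outside {m} : Fin (2 + m) → Fin (2 + m) → Set where
  uv : Outside zero (suc zero)
  vu : Outside (suc zero) zero

data VertexView {m} (p q : Fin (2 + m)) : Fin (2 + m) → Set where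
  is-p : VertexView p q p
  is-q : VertexView p q q
  is-ι : ∀ i → VertexView p q (ι i)

module _ {p q : Fin (2 + m)} where

  view : Outside p q → ∀ y → VertexView p q y
  view uv zero = is-p
  view uv (suc zero) = is-q
  view vu zero = is-q
  view vu (suc zero) = is-p
  view _ (suc (suc i)) = is-ι i

  p≢q : Outside p q → p ≢ q
  p≢q uv ()
  p≢q vu ()

  p≢ι : Outside p q → ∀ {i} → p ≢ ι i
  p≢ι uv ()
  p≢ι vu ()

  q≢ι : Outside p q → ∀ {i} → q ≢ ι i
  q≢ι uv ()
  q≢ι vu ()

module Configurations {O : Fin m → Fin m → Bool} (ends : PathEnds O) (x : Ext m)
                      {p q : Fin (2 + m)} (o : Outside p q) where

  open PathEnds ends

  private
    A : Fin (2 + m) → Fin (2 + m) → Bool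
    A = arc O x

    _⇒_ : Fin (2 + m) → Fin (2 + m) → Set
    s ⇒ t = T (A s t)

    lift : ∀ {i is j} → Walk O i is j → Walk A (ι i) (map ι is) (ι j)
    lift = Walk-map ι (λ i⟶j → i⟶j)

    map-ι-≢ : ∀ {j : Fin m} {is} → All (_≢ j) is → All (_≢ ι j) (map ι is)
    map-ι-≢ is≢j = map⁺ (All.map (λ i≢j → i≢j ∘ ι-injective) is≢j)

    ι-≢⁻ : ∀ {i j : Fin m} → ι i ≢ ι j → i ≢ j
    ι-≢⁻ ιi≢ιj = ιi≢ιj ∘ cong ι

  spanning∖q : p ⇒ ι w₁ → ι wₘ ⇒ p → SpanningClosedWalk A q
  spanning∖q p⇒w₁ wₘ⇒p =
    spanning (p⇒w₁ ∷ (lift w₁⇝wₘ ▷ wₘ⇒p)) avoids spans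
    where
    K = map ι (w₁ ∷ w₂ ∷ middle ∷ʳ wₘ)
    avoids : All (_≢ q) (K ∷ʳ p)
    avoids = ++⁺ (map⁺ (All.universal (λ _ → ≢-sym (q≢ι o)) (w₁ ∷ w₂ ∷ middle ∷ʳ wₘ))) (p≢q o ∷ [])
    spans : ∀ y → y ≢ q → y ∈ K ∷ʳ p
    spans y y≢q with view o y
    ... | is-p = ∈-++⁺ʳ K (here refl)
    ... | is-q = ⊥-elim (y≢q refl)
    ... | is-ι i = ∈-++⁺ˡ (∈-map⁺ ι (covers i))

  spanning∖wₘ : p ⇒ q → q ⇒ ι w₁ → ι wₚ ⇒ p → SpanningClosedWalk A (ι wₘ)
  spanning∖wₘ p⇒q q⇒w₁ wₚ⇒p =
    spanning (p⇒q ∷ q⇒w₁ ∷ (lift w₁⇝wₚ ▷ wₚ⇒p)) avoids spans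
    where
    K = map ι (w₁ ∷ w₂ ∷ middle)
    avoids : All (_≢ ι wₘ) (q ∷ K ∷ʳ p)
    avoids = q≢ι o ∷ ++⁺ (map-ι-≢ others≢wₘ) (p≢ι o ∷ [])
    spans : ∀ y → y ≢ ι wₘ → y ∈ q ∷ K ∷ʳ p
    spans y y≢wₘ with view o y
    ... | is-p = there (∈-++⁺ʳ K (here refl))
    ... | is-q = here refl
    ... | is-ι i = there (∈-++⁺ˡ (∈-map⁺ ι (covers-≢wₘ (ι-≢⁻ y≢wₘ))))

  spanning∖w₁ : p ⇒ q → q ⇒ ι w₂ → ι wₘ ⇒ p → SpanningClosedWalk A (ι w₁)
  spanning∖w₁ p⇒q q⇒w₂ wₘ⇒p =
    spanning (p⇒q ∷ q⇒w₂ ∷ (lift w₂⇝wₘ ▷ wₘ⇒p)) avoids spans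
    where
    K = map ι (w₂ ∷ middle ∷ʳ wₘ)
    avoids : All (_≢ ι w₁) (q ∷ K ∷ʳ p)
    avoids = q≢ι o ∷ ++⁺ (map-ι-≢ others≢w₁) (p≢ι o ∷ [])
    spans : ∀ y → y ≢ ι w₁ → y ∈ q ∷ K ∷ʳ p
    spans y y≢w₁ with view o y
    ... | is-p = there (∈-++⁺ʳ K (here refl))
    ... | is-q = here refl
    ... | is-ι i = there (∈-++⁺ˡ (∈-map⁺ ι (covers-≢w₁ (ι-≢⁻ y≢w₁))))

  spanning∖w₁′ : ι w₂ ⇒ p → p ⇒ ι wₘ → q ⇒ ι w₂ → ι wₘ ⇒ q → SpanningClosedWalk A (ι w₁)
  spanning∖w₁′ w₂⇒p p⇒wₘ q⇒w₂ wₘ⇒q =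
    spanning (q⇒w₂ ∷ w₂⇒p ∷ p⇒wₘ ∷ wₘ⇒q ∷ q⇒w₂ ∷ (lift w₂⇝wₘ ▷ wₘ⇒q)) avoids spans
    where
    K = map ι (w₂ ∷ middle ∷ʳ wₘ)
    K≢w₁ : All (_≢ ι w₁) K
    K≢w₁ = map-ι-≢ others≢w₁
    avoids : All (_≢ ι w₁) (ι w₂ ∷ p ∷ ι wₘ ∷ q ∷ K ∷ʳ q)
    avoids = All.head K≢w₁ ∷ p≢ι o ∷ All.lookup K≢w₁ (∈-map⁺ ι (∈-++⁺ʳ (w₂ ∷ middle) (here refl)))
           ∷ q≢ι o ∷ ++⁺ K≢w₁ (q≢ι o ∷ [])
    spans : ∀ y → y ≢ ι w₁ → y ∈ ι w₂ ∷ p ∷ ι wₘ ∷ q ∷ K ∷ʳ q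
    spans y y≢w₁ with view o y
    ... | is-p = there (here refl)
    ... | is-q = there (there (there (here refl)))
    ... | is-ι i = there (there (there (there (∈-++⁺ˡ (∈-map⁺ ι (covers-≢w₁ (ι-≢⁻ y≢w₁)))))))

-- A key restricts an extension to the vertices w₁, w₂, wₚ, wₘ.  Each list of literals is one
-- configuration of Configurations, with a_w, b_w, e read as u ⟶ w, v ⟶ w, u ⟶ v.
forbiddenPatterns : Ext 4 → List (List Bool)
forbiddenPatterns (e , a₁ ∷ a₂ ∷ aₚ ∷ aₘ ∷ [] , b₁ ∷ b₂ ∷ bₚ ∷ bₘ ∷ []) =
    (a₁ ∷ not aₘ ∷ [])
  ∷ (b₁ ∷ not bₘ ∷ [])
  ∷ (e ∷ b₁ ∷ not aₚ ∷ [])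
  ∷ (not e ∷ a₁ ∷ not bₚ ∷ [])
  ∷ (e ∷ b₂ ∷ not aₘ ∷ [])
  ∷ (not e ∷ a₂ ∷ not bₘ ∷ [])
  ∷ (not a₂ ∷ aₘ ∷ b₂ ∷ not bₘ ∷ [])
  ∷ []

Admissible : Ext 4 → Set
Admissible κ = All (λ literals → ¬ All T literals) (forbiddenPatterns κ)

admissible? : Decidable Admissible
admissible? κ = All.all? (λ literals → ¬? (All.all? T? literals)) (forbiddenPatterns κ)

_↾_ : Vec Bool m → (ks : List (Fin m)) → Vec Bool (length ks)
a ↾ ks = Vec.map (lookup a) (Vec.fromList ks)

restrict : (ks : List (Fin m)) → Ext m → Ext (length ks)
restrict ks (e , a , b) = e , a ↾ ks , b ↾ ks

module _ {O : Fin m → Fin m → Bool} (ends : PathEnds O) where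

  open PathEnds ends

  restrict-admissible : ∀ x → SkFree (suc m) (arc O x) → Admissible (restrict (w₁ ∷ w₂ ∷ wₚ ∷ wₘ ∷ []) x)
  restrict-admissible x skFree =
      (λ { (t₁ ∷ t₂ ∷ []) → ¬spanning (spanning∖q uv t₁ t₂) })
    ∷ (λ { (t₁ ∷ t₂ ∷ []) → ¬spanning (spanning∖q vu t₁ t₂) })
    ∷ (λ { (t₁ ∷ t₂ ∷ t₃ ∷ []) → ¬spanning (spanning∖wₘ uv t₁ t₂ t₃) })
    ∷ (λ { (t₁ ∷ t₂ ∷ t₃ ∷ []) → ¬spanning (spanning∖wₘ vu t₁ t₂ t₃) })
    ∷ (λ { (t₁ ∷ t₂ ∷ t₃ ∷ []) → ¬spanning (spanning∖w₁ uv t₁ t₂ t₃) })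
    ∷ (λ { (t₁ ∷ t₂ ∷ t₃ ∷ []) → ¬spanning (spanning∖w₁ vu t₁ t₂ t₃) })
    ∷ (λ { (t₁ ∷ t₂ ∷ t₃ ∷ t₄ ∷ []) → ¬spanning (spanning∖w₁′ uv t₁ t₂ t₃ t₄) })
    ∷ []
    where
    open Configurations ends x
    ¬spanning : ∀ {d} → ¬ SpanningClosedWalk (arc O x) d
    ¬spanning = SkFree⇒¬SpanningClosedWalk skFree

-- Counting extensions by their keys

bitVectors : ∀ n → List (Vec Bool n)
bitVectors zero = [ [] ]
bitVectors (suc n) = map (true ∷_) (bitVectors n) ++ map (false ∷_) (bitVectors n)

∈-bitVectors : (a : Vec Bool n) → a ∈ bitVectors n
∈-bitVectors [] = here refl
∈-bitVectors (true ∷ a) = ∈-++⁺ˡ (∈-map⁺ (true ∷_) (∈-bitVectors a))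
∈-bitVectors {suc n} (false ∷ a) = ∈-++⁺ʳ (map (true ∷_) (bitVectors n)) (∈-map⁺ (false ∷_) (∈-bitVectors a))

length-bitVectors : ∀ n → length (bitVectors n) ≡ 2 ^ n
length-bitVectors zero = refl
length-bitVectors (suc n) =
  trans (length-++ (map (true ∷_) (bitVectors n)))
        (cong₂ _+_ (trans (length-map (true ∷_) (bitVectors n)) (length-bitVectors n))
                   (trans (length-map (false ∷_) (bitVectors n))
                          (trans (length-bitVectors n) (sym (+-identityʳ (2 ^ n))))))

extensions : ∀ n → List (Ext n)
extensions n = cartesianProduct (true ∷ false ∷ []) (cartesianProduct (bitVectors n) (bitVectors n))

∈-extensions : (x : Ext n) → x ∈ extensions n
∈-extensions (e , a , b) =
  ∈-cartesianProduct⁺ (∈-bool e) (∈-cartesianProduct⁺ (∈-bitVectors a) (∈-bitVectors b))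
  where
  ∈-bool : ∀ e → e ∈ true ∷ false ∷ []
  ∈-bool true = here refl
  ∈-bool false = there (here refl)

↾-lookup : ∀ (a a′ : Vec Bool m) ks → a ↾ ks ≡ a′ ↾ ks → ∀ {i} → i ∈ ks → lookup a i ≡ lookup a′ i
↾-lookup a a′ (k ∷ ks) a↾≡ (here refl) = proj₁ (∷-injective a↾≡)
↾-lookup a a′ (k ∷ ks) a↾≡ (there i∈ks) = ↾-lookup a a′ ks (proj₂ (∷-injective a↾≡)) i∈ks

module _ (ks rs : List (Fin m)) (spans : ∀ i → i ∈ ks ++ rs) where

  ↾-injective : ∀ (a a′ : Vec Bool m) → a ↾ ks ≡ a′ ↾ ks → a ↾ rs ≡ a′ ↾ rs → a ≡ a′
  ↾-injective a a′ onKs onRs = begin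
    a                        ≡⟨ sym (tabulate∘lookup a) ⟩
    Vec.tabulate (lookup a)  ≡⟨ tabulate-cong lookup≡ ⟩
    Vec.tabulate (lookup a′) ≡⟨ tabulate∘lookup a′ ⟩
    a′                       ∎
    where
    open ≡-Reasoning
    lookup≡ : ∀ i → lookup a i ≡ lookup a′ i
    lookup≡ i with ∈-++⁻ ks (spans i)
    ... | inj₁ i∈ks = ↾-lookup a a′ ks onKs i∈ks
    ... | inj₂ i∈rs = ↾-lookup a a′ rs onRs i∈rs

  private
    Rest = Vec Bool (length rs)

    split : Ext m → Ext (length ks) × Rest × Rest
    split (e , a , b) = restrict ks (e , a , b) , a ↾ rs , b ↾ rs

    split-injective : ∀ {x y} → split x ≡ split y → x ≡ y
    split-injective {e , a , b} {e′ , a′ , b′} eq =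
      cong₂ _,_ (cong (proj₁ ∘ proj₁) eq)
        (cong₂ _,_ (↾-injective a a′ (cong (proj₁ ∘ proj₂ ∘ proj₁) eq) (cong (proj₁ ∘ proj₂) eq))
                   (↾-injective b b′ (cong (proj₂ ∘ proj₂ ∘ proj₁) eq) (cong (proj₂ ∘ proj₂) eq)))

  CountLess-restrict : (P : Ext m → Set) (G : List (Ext (length ks))) →
    (∀ x → P x → restrict ks x ∈ G) →
    CountLess P (suc (length G * (2 ^ length rs * 2 ^ length rs)))
  CountLess-restrict P G keys∈G xs unique Pxs = s≤s (begin
    length xs                ≡⟨ length-map split xs ⟨
    length (map split xs)    ≤⟨ Unique-⊆⇒length≤ (Unique-map⁺ split-injective unique) split⊆ ⟩
    length candidates        ≡⟨ length-candidates ⟩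
    length G * (2 ^ length rs * 2 ^ length rs) ∎)
    where
    open ≤-Reasoning
    candidates = cartesianProduct G (cartesianProduct (bitVectors (length rs)) (bitVectors (length rs)))
    length-candidates : length candidates ≡ length G * (2 ^ length rs * 2 ^ length rs)
    length-candidates
      rewrite length-cartesianProduct G (cartesianProduct (bitVectors (length rs)) (bitVectors (length rs)))
            | length-cartesianProduct (bitVectors (length rs)) (bitVectors (length rs))
            | length-bitVectors (length rs) = refl
    split⊆ : map split xs ⊆ candidates
    split⊆ s∈ with ∈-map⁻ split s∈
    ... | (e , a , b) , x∈xs , refl = ∈-cartesianProduct⁺ (keys∈G _ (All.lookup Pxs x∈xs))
          (∈-cartesianProduct⁺ (∈-bitVectors (a ↾ rs)) (∈-bitVectors (b ↾ rs)))

CountLess-mono : {X : Set} {P : X → Set} {B B′ : ℕ} → B ≤ B′ → CountLess P B → CountLess P B′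
CountLess-mono B≤B′ count xs unique Pxs = ≤-trans (count xs unique Pxs) B≤B′

admissibleKeys : List (Ext 4)
admissibleKeys = filter admissible? (extensions 4)

length-admissibleKeys : length admissibleKeys ≡ 186
length-admissibleKeys = refl

widen : Ext 3 → Ext 4
widen (e , a₁ ∷ a₂ ∷ a₃ ∷ [] , b₁ ∷ b₂ ∷ b₃ ∷ []) = e , a₁ ∷ a₂ ∷ a₂ ∷ a₃ ∷ [] , b₁ ∷ b₂ ∷ b₂ ∷ b₃ ∷ []

admissibleKeys₃ : List (Ext 3)
admissibleKeys₃ = filter (admissible? ∘ widen) (extensions 3)

length-admissibleKeys₃ : length admissibleKeys₃ ≡ 46
length-admissibleKeys₃ = refl

module _ (O : Fin 3 → Fin 3 → Bool) where

  cSk≤46 : IsTournament 3 O → CSkLess 4 O (suc 46)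
  cSk≤46 tournament = viaPath vertices linked enumerates (↭-length enumerates)
    where
    open HamiltonianPath (Rédei.hamiltonianPath O tournament)
    viaPath : (L : List (Fin 3)) → Linked (λ x y → T (O x y)) L → L ↭ allFin 3 → length L ≡ 3 →
              CSkLess 4 O (suc 46)
    viaPath (w₁ ∷ w₂ ∷ w₃ ∷ []) (w₁⟶w₂ ∷ w₂⟶w₃ ∷ [-]) enumerates _ =
      subst (λ g → CSkLess 4 O (suc (g * 1))) length-admissibleKeys₃
        (CountLess-restrict (w₁ ∷ w₂ ∷ w₃ ∷ []) [] (↭-allFin⇒∈ enumerates) _ admissibleKeys₃
          λ x skFree → ∈-filter⁺ (admissible? ∘ widen) (∈-extensions _) (restrict-admissible ends x skFree))
      where
      ends : PathEnds O
      ends = record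
        { w₁ = w₁ ; w₂ = w₂ ; wₚ = w₂ ; wₘ = w₃ ; middle = []
        ; w₁⟶w₂ = w₁⟶w₂ ; w₂⇝wₚ = [] ; wₚ⟶wₘ = w₂⟶w₃ ; enumerates = enumerates }
    viaPath [] _ _ ()
    viaPath (_ ∷ []) _ _ ()
    viaPath (_ ∷ _ ∷ []) _ _ ()
    viaPath (_ ∷ _ ∷ _ ∷ _ ∷ _) _ _ ()

module _ {j} (O : Fin (4 + j) → Fin (4 + j) → Bool) where

  cSk≤186·4ʲ : IsTournament (4 + j) O → CSkLess (5 + j) O (suc (186 * (2 ^ j * 2 ^ j)))
  cSk≤186·4ʲ tournament = viaPath vertices linked enumerates (fourEnds? vertices 4≤length)
    where
    open HamiltonianPath (Rédei.hamiltonianPath O tournament)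
    4≤length : 4 ≤ length vertices
    4≤length = subst (4 ≤_) (sym (↭-length enumerates)) (s≤s (s≤s (s≤s (s≤s z≤n))))
    viaPath : (L : List (Fin (4 + j))) → Linked (λ x y → T (O x y)) L → L ↭ allFin (4 + j) →
              FourEnds L → CSkLess (5 + j) O (suc (186 * (2 ^ j * 2 ^ j)))
    viaPath _ (w₁⟶w₂ ∷ linked) enumerates (fourEnds w₁ w₂ mid wₚ wₘ) =
      subst (CSkLess (5 + j) O) (cong₂ (λ g r → suc (g * (2 ^ r * 2 ^ r))) length-admissibleKeys |mid|≡j)
        (CountLess-restrict keys mid (↭-allFin⇒∈ keys++mid↭) _ admissibleKeys
          λ x skFree → ∈-filter⁺ admissible? (∈-extensions _) (restrict-admissible ends x skFree))
      where
      keys = w₁ ∷ w₂ ∷ wₚ ∷ wₘ ∷ []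
      w₂⇝wₚ,wₚ⟶wₘ = Linked⇒Walk▷ mid linked
      ends : PathEnds O
      ends = record
        { w₁ = w₁ ; w₂ = w₂ ; wₚ = wₚ ; wₘ = wₘ ; middle = mid ∷ʳ wₚ ; w₁⟶w₂ = w₁⟶w₂
        ; w₂⇝wₚ = proj₁ w₂⇝wₚ,wₚ⟶wₘ ; wₚ⟶wₘ = proj₂ w₂⇝wₚ,wₚ⟶wₘ ; enumerates = enumerates }
      keys++mid↭ : keys ++ mid ↭ allFin (4 + j)
      keys++mid↭ = ↭-trans (prep w₁ (prep w₂ (∷∷↭∷ʳ∷ʳ wₚ wₘ mid))) enumerates
      |mid|≡j : length mid ≡ j
      |mid|≡j = +-cancelˡ-≡ 4 _ _ (trans (↭-length keys++mid↭) (length-tabulate id))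

6·2^[2k∸5] : ∀ j → 2 * 3 * 2 ^ (2 * (5 + j) ∸ 5) ≡ 192 * (2 ^ j * 2 ^ j)
6·2^[2k∸5] j = begin
  2 * 3 * 2 ^ (2 * (5 + j) ∸ 5)     ≡⟨ cong (6 *_) (^-distribˡ-+-* 2 j (5 + (j + 0))) ⟩
  6 * (2 ^ j * 2 ^ (5 + (j + 0)))   ≡⟨ cong (λ i → 6 * (2 ^ j * 2 ^ (5 + i))) (+-identityʳ j) ⟩
  6 * (2 ^ j * 2 ^ (5 + j))         ≡⟨ 6·[t·2⁵t]≡192·[t·t] (2 ^ j) ⟩
  192 * (2 ^ j * 2 ^ j)             ∎
  where
  open ≡-Reasoning
  6·[t·2⁵t]≡192·[t·t] : ∀ t → 6 * (t * (2 * (2 * (2 * (2 * (2 * t)))))) ≡ 192 * (t * t)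
  6·[t·2⁵t]≡192·[t·t] = solve-∀

186·4ʲ<6·2^[2k∸5] : ∀ j → 186 * (2 ^ j * 2 ^ j) < 2 * 3 * 2 ^ (2 * (5 + j) ∸ 5)
186·4ʲ<6·2^[2k∸5] j = subst (186 * 4ʲ <_) (sym (6·2^[2k∸5] j))
  (*-monoˡ-< 4ʲ {{m*n≢0 (2 ^ j) (2 ^ j) {{m^n≢0 2 j}} {{m^n≢0 2 j}}}} (m<m+n 186 {6} z<s))
  where 4ʲ = 2 ^ j * 2 ^ j

lemma3p4 : (k : ℕ) → 4 ≤ k → (n : ℕ) → (G : Graph n)
  → (K : Fin (k ∸ 1) → Fin n) → IsCompleteSubgraph G (k ∸ 1) K
  → (u v : Fin n) → (∀ i → K i ≢ u) → (∀ i → K i ≢ v)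
  → Adj G u v → (∀ i → Adj G u (K i)) → (∀ i → Adj G v (K i))
  → (O : Fin (k ∸ 1) → Fin (k ∸ 1) → Bool) → IsTournament (k ∸ 1) O
  → CSkLess k O (2 * 3 * 2 ^ (2 * k ∸ 5))
lemma3p4 0 ()
lemma3p4 1 (s≤s ())
lemma3p4 2 (s≤s (s≤s ()))
lemma3p4 3 (s≤s (s≤s (s≤s ())))
lemma3p4 4 _ _ _ _ _ _ _ _ _ _ _ _ O tournament =
  CountLess-mono (n≤1+n 47) (cSk≤46 O tournament)
lemma3p4 (suc (suc (suc (suc (suc j))))) _ _ _ _ _ _ _ _ _ _ _ _ O tournament =
  CountLess-mono (186·4ʲ<6·2^[2k∸5] j) (cSk≤186·4ʲ O tournament)
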